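{- Let $\mathcal{D}=(\mathcal{P},\mathcal{B},\mathcal{I})$ be a $2$-design and $G\le\mathrm{Aut}(\mathcal{D})$. If $\mathcal{D}$ is $G$-locally primitive, then $\mathcal{D}$ is $G$-flag-transitive and $G$ is primitive on $\mathcal{P}$.
   Context: A $2$-design has a finite point set $\mathcal{P}$ ($|\mathcal{P}|\ge2$), finite block set $\mathcal{B}$, each block incident with $k$ points and any two distinct points incident with exactly $\lambda\ge1$ blocks. $\mathcal{D}(\alpha)$ is the set of blocks incident with a point $\alpha$, $\mathcal{D}(\beta)$ the set of points incident with a block $\beta$. $\mathcal{D}$ is $G$-locally primitive if $G_\alpha$ is primitive on $\mathcal{D}(\alpha)$ for every point $\alpha$ and $G_\beta$ is primitive on $\mathcal{D}(\beta)$ for every block $\beta$. $G$-flag-transitive means $G$ is transitive on the set of incident point-block pairs. -}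

module Defs where

open import Level using (Level; _⊔_)
open import Data.Nat using (ℕ; _≤_; _≥_)
open import Data.Bool using (Bool; true)
open import Data.Fin using (Fin)
open import Data.Fin.Subset using (Subset; _∈_; _∉_; _∩_; ∣_∣; ⊤)
open import Data.Vec using (tabulate)
open import Data.Product using (Σ; _×_; ∃; ∃-syntax)
open import Data.Sum using (_⊎_)
open import Relation.Nullary using (¬_)
open import Relation.Binary.PropositionalEquality using (_≡_)
open import Algebra.Bundles using (Group)

-- An incidence structure with point set Fin v, block set Fin b and
-- incidence relation I α β ≡ true.  Blocks are abstract (repeats allowed).
Incidence : ℕ → ℕ → Set
Incidence v b = Fin v → Fin b → Bool

blocksOf : ∀ {v b} → Incidence v b → Fin v → Subset b
blocksOf I α = tabulate (λ β → I α β)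

pointsOf : ∀ {v b} → Incidence v b → Fin b → Subset v
pointsOf I β = tabulate (λ α → I α β)

record Is2Design {v b : ℕ} (I : Incidence v b) (k lam : ℕ) : Set where
  field
    two≤v     : 2 ≤ v
    blockSize : ∀ β → ∣ pointsOf I β ∣ ≡ k
    pairCount : ∀ α α' → ¬ (α ≡ α') → ∣ blocksOf I α ∩ blocksOf I α' ∣ ≡ lam
    lam≥1     : lam ≥ 1

-- A group G acting faithfully by automorphisms of the incidence
-- structure, i.e. (an isomorphic copy of) a subgroup G ≤ Aut(𝒟).
record AutAction {c ℓ : Level} {v b : ℕ} (I : Incidence v b)
                 (G : Group c ℓ) : Set (c ⊔ ℓ) where
  open Group G
  field
    actP : Carrier → Fin v → Fin v
    actB : Carrier → Fin b → Fin b
    actP-cong : ∀ {g h} → g ≈ h → ∀ α → actP g α ≡ actP h α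
    actB-cong : ∀ {g h} → g ≈ h → ∀ β → actB g β ≡ actB h β
    actP-ε    : ∀ α → actP ε α ≡ α
    actB-ε    : ∀ β → actB ε β ≡ β
    actP-∙    : ∀ g h α → actP (g ∙ h) α ≡ actP g (actP h α)
    actB-∙    : ∀ g h β → actB (g ∙ h) β ≡ actB g (actB h β)
    preserves : ∀ g α β → I (actP g α) (actB g β) ≡ I α β
    faithful  : ∀ g → (∀ α → actP g α ≡ α) → (∀ β → actB g β ≡ β) → g ≈ ε

TransitiveOn : ∀ {c} {A : Set c} {n : ℕ} → (A → Set) → (A → Fin n → Fin n)
             → Subset n → Set c
TransitiveOn {A = A} H act S =
  ∀ x y → x ∈ S → y ∈ S → ∃[ g ] (H g × act g x ≡ y)

IsBlockOn : ∀ {c} {A : Set c} {n : ℕ} → (A → Set) → (A → Fin n → Fin n)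
          → Subset n → Subset n → Set c
IsBlockOn {A = A} H act S Δ =
  (∀ x → x ∈ Δ → x ∈ S) ×
  (∀ g → H g → (∀ x → x ∈ Δ → act g x ∈ Δ) ⊎ (∀ x → x ∈ Δ → act g x ∉ Δ))

PrimitiveOn : ∀ {c} {A : Set c} {n : ℕ} → (A → Set) → (A → Fin n → Fin n)
            → Subset n → Set c
PrimitiveOn {n = n} H act S =
  TransitiveOn H act S ×
  (∀ (Δ : Subset n) → IsBlockOn H act S Δ → ∣ Δ ∣ ≤ 1 ⊎ (∀ x → x ∈ S → x ∈ Δ))

module _ {c ℓ : Level} {v b : ℕ} {I : Incidence v b} {G : Group c ℓ}
         (A : AutAction I G) where
  open Group G
  open AutAction A

  LocallyPrimitive : Set c
  LocallyPrimitive =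
    (∀ α → PrimitiveOn (λ g → actP g α ≡ α) actB (blocksOf I α)) ×
    (∀ β → PrimitiveOn (λ g → actB g β ≡ β) actP (pointsOf I β))

  FlagTransitive : Set c
  FlagTransitive =
    ∀ α β α' β' → I α β ≡ true → I α' β' ≡ true →
    ∃[ g ] (actP g α ≡ α' × actB g β ≡ β')

  PrimitiveOnPoints : Set c
  PrimitiveOnPoints = PrimitiveOn {A = Carrier} (λ _ → Data.Unit.⊤) actP ⊤
    where import Data.Unit

{-# OPTIONS --safe #-}

-- Since λ ≥ 1, any two distinct points lie on a common block, and this is
-- all the combinatorics needed.  Flag-transitivity: to move a flag (α, β)
-- to (α', β'), turn β about α onto a block γ through α and α', slide α
-- along γ to α', and turn γ about α' onto β'; each move is supplied by the
-- local transitivity of a point or block stabiliser.  Primitivity on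
-- points: if a block of imprimitivity Δ contains two points, it meets a
-- block β joining them in a block of imprimitivity of G_β on 𝒟(β) with two
-- points, so 𝒟(β) ⊆ Δ; and for any point x, some element of G_α (α ∈ 𝒟(β)
-- ∩ Δ) stabilises Δ and carries β onto a block through x, so x ∈ Δ.
module Submission where

open import Defs
open import Level using (Level)
open import Data.Nat using (ℕ; _≤_; _<_; z≤n)
open import Data.Nat.Properties using (≤-trans; ≤-reflexive; ≤-<-trans; <⇒≱)
open import Data.Bool using (Bool; true)
open import Data.Fin using (Fin; _≟_)
open import Data.Fin.Properties using (any?)
open import Data.Fin.Subset
  using (Subset; _∈_; _∉_; _∩_; _⊆_; ∣_∣; ⊤; ⁅_⁆; Empty)
open import Data.Fin.Subset.Properties
  using ( _∈?_; nonempty?; Empty-unique; ∣⊥∣≡0; x∈⁅x⁆; ∣⁅x⁆∣≡1; p⊆q⇒∣p∣≤∣q∣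
        ; x∈p∩q⁺; x∈p∩q⁻; x∈p∧x≢y⇒x∈p-y; x∈p⇒∣p-x∣<∣p∣)
open import Data.Vec using (tabulate)
open import Data.Vec.Properties using (lookup∘tabulate; lookup⇒[]=; []=⇒lookup)
open import Data.Product using (_×_; _,_; proj₁; proj₂; ∃₂; ∃-syntax; map₂; swap)
open import Data.Sum using (_⊎_; inj₁; inj₂)
open import Data.Unit using (tt) renaming (⊤ to Unit)
open import Function using (_∘_)
open import Relation.Nullary using (yes; no; contradiction; ¬?; _×-dec_)
open import Relation.Nullary.Decidable using (decidable-stable)
open import Relation.Binary.PropositionalEquality
  using (_≡_; _≢_; refl; sym; trans; cong; cong₂; subst; module ≡-Reasoning)
open import Algebra.Bundles using (Group)

module _ {n : ℕ} where

  ∈-tabulate⁺ : ∀ (f : Fin n → Bool) {x} → f x ≡ true → x ∈ tabulate f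
  ∈-tabulate⁺ f {x} fx = lookup⇒[]= x (tabulate f) (trans (lookup∘tabulate f x) fx)

  ∈-tabulate⁻ : ∀ (f : Fin n → Bool) {x} → x ∈ tabulate f → f x ≡ true
  ∈-tabulate⁻ f {x} x∈ = trans (sym (lookup∘tabulate f x)) ([]=⇒lookup x∈)

  Empty⇒∣p∣≡0 : ∀ {p : Subset n} → Empty p → ∣ p ∣ ≡ 0
  Empty⇒∣p∣≡0 p-empty = trans (cong ∣_∣ (Empty-unique p-empty)) (∣⊥∣≡0 n)

  x≢y∈p⇒1<∣p∣ : ∀ {p : Subset n} {x y} → x ≢ y → x ∈ p → y ∈ p → 1 < ∣ p ∣
  x≢y∈p⇒1<∣p∣ x≢y x∈p y∈p =
    ≤-<-trans (≤-<-trans z≤n (x∈p⇒∣p-x∣<∣p∣ (x∈p∧x≢y⇒x∈p-y x∈p x≢y)))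
              (x∈p⇒∣p-x∣<∣p∣ y∈p)

  ∣p∣≤1⊎two-elements : ∀ (p : Subset n) →
                       ∣ p ∣ ≤ 1 ⊎ ∃₂ λ x y → x ≢ y × x ∈ p × y ∈ p
  ∣p∣≤1⊎two-elements p with nonempty? p
  ... | no p-empty =
    inj₁ (≤-trans (≤-reflexive (Empty⇒∣p∣≡0 p-empty)) z≤n)
  ... | yes (x , x∈p) with any? (λ y → y ∈? p ×-dec ¬? (y ≟ x))
  ...   | yes (y , y∈p , y≢x) = inj₂ (y , x , y≢x , y∈p , x∈p)
  ...   | no  no-other =
    inj₁ (≤-trans (p⊆q⇒∣p∣≤∣q∣ p⊆⁅x⁆) (≤-reflexive (∣⁅x⁆∣≡1 x)))
    where
    p⊆⁅x⁆ : p ⊆ ⁅ x ⁆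
    p⊆⁅x⁆ {y} y∈p =
      subst (_∈ ⁅ x ⁆) (sym (decidable-stable (y ≟ x) (λ y≢x → no-other (y , y∈p , y≢x))))
            (x∈⁅x⁆ x)

IsBlockOn-∩ : ∀ {c} {A : Set c} {n} {H K : A → Set} {act : A → Fin n → Fin n}
                {S T Δ : Subset n} →
              (∀ g → K g → H g) →
              (∀ g → K g → ∀ x → x ∈ T → act g x ∈ T) →
              IsBlockOn H act S Δ → IsBlockOn K act T (Δ ∩ T)
IsBlockOn-∩ {K = K} {act} {T = T} {Δ} K⊆H T-invariant (_ , Δ-block) =
  (λ _ → proj₂ ∘ x∈p∩q⁻ Δ T) , block
  where
  block : ∀ g → K g → (∀ x → x ∈ Δ ∩ T → act g x ∈ Δ ∩ T) ⊎ (∀ x → x ∈ Δ ∩ T → act g x ∉ Δ ∩ T)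
  block g Kg with Δ-block g (K⊆H g Kg)
  ... | inj₁ gΔ⊆Δ = inj₁ λ x x∈Δ∩T →
    let x∈Δ , x∈T = x∈p∩q⁻ Δ T x∈Δ∩T
    in  x∈p∩q⁺ (gΔ⊆Δ x x∈Δ , T-invariant g Kg x x∈T)
  ... | inj₂ gΔ∩Δ≡∅ = inj₂ λ x x∈Δ∩T gx∈Δ∩T →
    gΔ∩Δ≡∅ x (proj₁ (x∈p∩q⁻ Δ T x∈Δ∩T)) (proj₁ (x∈p∩q⁻ Δ T gx∈Δ∩T))

Collinear : ∀ {v b} → Incidence v b → Set
Collinear I = ∀ α α' → α ≢ α' → ∃[ β ] (I α β ≡ true × I α' β ≡ true)

2-design⇒collinear : ∀ {v b} {I : Incidence v b} {k lam} → Is2Design I k lam → Collinear I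
2-design⇒collinear {I = I} D α α' α≢α'
  with nonempty? (blocksOf I α ∩ blocksOf I α')
... | yes (β , β∈both) =
  let β∈α , β∈α' = x∈p∩q⁻ (blocksOf I α) (blocksOf I α') β∈both
  in  β , ∈-tabulate⁻ (I α) β∈α , ∈-tabulate⁻ (I α') β∈α'
... | no none
  with subst (1 ≤_) (trans (sym (Is2Design.pairCount D α α' α≢α')) (Empty⇒∣p∣≡0 none))
             (Is2Design.lam≥1 D)
...   | ()

module AutActionProperties {c ℓ} {v b} {I : Incidence v b} {G : Group c ℓ}
                           (A : AutAction I G) where
  open Group G using (Carrier; _∙_; ε; _⁻¹; inverseʳ)
  open AutAction A

  PointStabilizer : Fin v → Carrier → Set
  PointStabilizer α g = actP g α ≡ α

  BlockStabilizer : Fin b → Carrier → Set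
  BlockStabilizer β g = actB g β ≡ β

  infix 4 _↝_
  _↝_ : Fin v × Fin b → Fin v × Fin b → Set c
  (α , β) ↝ (α' , β') = ∃[ g ] (actP g α ≡ α' × actB g β ≡ β')

  ↝-trans : ∀ {f f' f''} → f ↝ f' → f' ↝ f'' → f ↝ f''
  ↝-trans {α , β} (g , gα≡α' , gβ≡β') (h , hα'≡α'' , hβ'≡β'') =
    h ∙ g , trans (actP-∙ h g α) (trans (cong (actP h) gα≡α') hα'≡α'')
          , trans (actB-∙ h g β) (trans (cong (actB h) gβ≡β') hβ'≡β'')

  actP-inverseʳ : ∀ g α → actP g (actP (g ⁻¹) α) ≡ α
  actP-inverseʳ g α = begin
    actP g (actP (g ⁻¹) α)  ≡⟨ actP-∙ g (g ⁻¹) α ⟨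
    actP (g ∙ g ⁻¹) α       ≡⟨ actP-cong (inverseʳ g) α ⟩
    actP ε α                ≡⟨ actP-ε α ⟩
    α                       ∎
    where open ≡-Reasoning

  incident-pullback : ∀ g {α β γ} → actB g β ≡ γ → I α γ ≡ true →
                      I (actP (g ⁻¹) α) β ≡ true
  incident-pullback g {α} {β} {γ} gβ≡γ αIγ = begin
    I (actP (g ⁻¹) α) β                    ≡⟨ preserves g (actP (g ⁻¹) α) β ⟨
    I (actP g (actP (g ⁻¹) α)) (actB g β)  ≡⟨ cong₂ I (actP-inverseʳ g α) gβ≡γ ⟩
    I α γ                                  ≡⟨ αIγ ⟩
    true                                   ∎
    where open ≡-Reasoning

  pointsOf-invariant : ∀ β g → BlockStabilizer β g →
                       ∀ α → α ∈ pointsOf I β → actP g α ∈ pointsOf I β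
  pointsOf-invariant β g gβ≡β α α∈β = ∈-tabulate⁺ (λ x → I x β) (begin
    I (actP g α) β           ≡⟨ cong (I (actP g α)) gβ≡β ⟨
    I (actP g α) (actB g β)  ≡⟨ preserves g α β ⟩
    I α β                    ≡⟨ ∈-tabulate⁻ (λ x → I x β) α∈β ⟩
    true                     ∎)
    where open ≡-Reasoning

  module LocallyTransitive
    (collinear : Collinear I)
    (point-stabilizers-transitive :
       ∀ α → TransitiveOn (PointStabilizer α) actB (blocksOf I α))
    (block-stabilizers-transitive :
       ∀ β → TransitiveOn (BlockStabilizer β) actP (pointsOf I β))
    where

    turn-about : ∀ {α β β'} → I α β ≡ true → I α β' ≡ true → (α , β) ↝ (α , β')
    turn-about {α} αIβ αIβ' =
      point-stabilizers-transitive α _ _ (∈-tabulate⁺ (I α) αIβ) (∈-tabulate⁺ (I α) αIβ')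

    slide-along : ∀ {α α' β} → I α β ≡ true → I α' β ≡ true → (α , β) ↝ (α' , β)
    slide-along {β = β} αIβ α'Iβ = map₂ swap
      (block-stabilizers-transitive β _ _ (∈-tabulate⁺ (λ x → I x β) αIβ)
                                          (∈-tabulate⁺ (λ x → I x β) α'Iβ))

    flagTransitive : FlagTransitive A
    flagTransitive α β α' β' αIβ α'Iβ' with α ≟ α'
    ... | yes refl = turn-about αIβ α'Iβ'
    ... | no α≢α' =
      let γ , αIγ , α'Iγ = collinear α α' α≢α'
      in  ↝-trans (turn-about αIβ αIγ) (↝-trans (slide-along αIγ α'Iγ) (turn-about α'Iγ α'Iβ'))

    pointTransitive : TransitiveOn {A = Carrier} (λ _ → Unit) actP ⊤
    pointTransitive α α' _ _ with α ≟ α'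
    ... | yes refl = ε , tt , actP-ε α
    ... | no α≢α' =
      let γ , αIγ , α'Iγ = collinear α α' α≢α'
          g , gα≡α' , _ = slide-along αIγ α'Iγ
      in  g , tt , gα≡α'

    block-spreads : ∀ {Δ α β} → IsBlockOn {A = Carrier} (λ _ → Unit) actP ⊤ Δ →
                    α ∈ Δ → I α β ≡ true → (∀ x → I x β ≡ true → x ∈ Δ) →
                    ∀ x → x ∈ Δ
    block-spreads {Δ} {α} (_ , Δ-block) α∈Δ αIβ β⊆Δ x with x ≟ α
    ... | yes refl = α∈Δ
    ... | no x≢α with collinear α x (x≢α ∘ sym)
    ...   | γ , αIγ , xIγ with turn-about αIβ αIγ
    ...     | g , gα≡α , gβ≡γ with Δ-block g tt
    ...       | inj₁ gΔ⊆Δ =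
      subst (_∈ Δ) (actP-inverseʳ g x) (gΔ⊆Δ _ (β⊆Δ _ (incident-pullback g gβ≡γ xIγ)))
    ...       | inj₂ gΔ∩Δ≡∅ = contradiction (subst (_∈ Δ) (sym gα≡α) α∈Δ) (gΔ∩Δ≡∅ α α∈Δ)

    module _ (block-stabilizers-primitive :
                ∀ β → PrimitiveOn (BlockStabilizer β) actP (pointsOf I β)) where

      block⊇pointsOf : ∀ {Δ α α' β} → IsBlockOn {A = Carrier} (λ _ → Unit) actP ⊤ Δ →
                       α ≢ α' → α ∈ Δ → α' ∈ Δ → I α β ≡ true → I α' β ≡ true →
                       ∀ x → I x β ≡ true → x ∈ Δ
      block⊇pointsOf {Δ} {α} {α'} {β} Δ-block α≢α' α∈Δ α'∈Δ αIβ α'Iβ x xIβ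
        with proj₂ (block-stabilizers-primitive β) (Δ ∩ pointsOf I β)
                   (IsBlockOn-∩ (λ _ _ → tt) (pointsOf-invariant β) Δ-block)
      ... | inj₁ ∣Δ∩β∣≤1 = contradiction ∣Δ∩β∣≤1 (<⇒≱ (x≢y∈p⇒1<∣p∣ α≢α'
              (x∈p∩q⁺ (α∈Δ , ∈-tabulate⁺ (λ y → I y β) αIβ))
              (x∈p∩q⁺ (α'∈Δ , ∈-tabulate⁺ (λ y → I y β) α'Iβ))))
      ... | inj₂ β⊆Δ∩β =
        proj₁ (x∈p∩q⁻ Δ (pointsOf I β) (β⊆Δ∩β x (∈-tabulate⁺ (λ y → I y β) xIβ)))

      pointPrimitive : PrimitiveOnPoints A
      pointPrimitive = pointTransitive , blocks-trivial
        where
        blocks-trivial : ∀ Δ → IsBlockOn {A = Carrier} (λ _ → Unit) actP ⊤ Δ →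
                         ∣ Δ ∣ ≤ 1 ⊎ (∀ x → x ∈ ⊤ → x ∈ Δ)
        blocks-trivial Δ Δ-block with ∣p∣≤1⊎two-elements Δ
        ... | inj₁ ∣Δ∣≤1 = inj₁ ∣Δ∣≤1
        ... | inj₂ (α , α' , α≢α' , α∈Δ , α'∈Δ) =
          let β , αIβ , α'Iβ = collinear α α' α≢α'
              β⊆Δ = block⊇pointsOf Δ-block α≢α' α∈Δ α'∈Δ αIβ α'Iβ
          in  inj₂ λ x _ → block-spreads Δ-block α∈Δ αIβ β⊆Δ x

lemma5p1 : {c ℓ : Level} {v b : ℕ} (I : Incidence v b) (k lam : ℕ)
           → Is2Design I k lam
           → (G : Group c ℓ) (A : AutAction I G)
           → LocallyPrimitive A
           → FlagTransitive A × PrimitiveOnPoints A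
lemma5p1 I k lam D G A (point-stabilizers-primitive , block-stabilizers-primitive) =
  flagTransitive , pointPrimitive block-stabilizers-primitive
  where
  open AutActionProperties A
  open LocallyTransitive (2-design⇒collinear D)
                         (proj₁ ∘ point-stabilizers-primitive)
                         (proj₁ ∘ block-stabilizers-primitive)
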